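{- For any finite simple graphs $G$ and $H$ of orders $n_1$ and $n_2$ respectively, $$\gamma_R(G\Box H)\le 2\gamma(G)\gamma(H)+(n_1-\gamma(G))(n_2-\gamma(H)).$$
   Context: $\gamma(X)$ denotes the domination number of a graph $X$ (minimum size of a set $D$ such that every vertex outside $D$ has a neighbor in $D$). A Roman dominating function on $X$ is a map $f:V(X)\to\{0,1,2\}$ such that every vertex $v$ with $f(v)=0$ has a neighbor $u$ with $f(u)=2$; $\gamma_R(X)$ is the minimum of $\sum_v f(v)$ over such $f$. The Cartesian product $G\Box H$ has vertex set $V(G)\times V(H)$, with $(g,h)\sim(g',h')$ iff ($g=g'$ and $h\sim h'$) or ($g\sim g'$ and $h=h'$). -}

module Defs where

open import Data.Nat using (ℕ; _+_; _*_; _≤_)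
open import Data.Bool using (Bool; true; false; T)
open import Data.Fin using (Fin)
open import Data.Fin.Subset using (Subset; _∈_; _∉_; ∣_∣)
open import Data.Product using (Σ; ∃; _×_; _,_)
open import Data.Sum using (_⊎_)
open import Data.List using (List; map; allFin)
open import Data.Nat.ListAction using (sum)
open import Relation.Binary.PropositionalEquality using (_≡_)
open import Relation.Nullary using (¬_)

record Graph (n : ℕ) : Set where
  field
    adj    : Fin n → Fin n → Bool
    sym    : ∀ u v → adj u v ≡ adj v u
    irrefl : ∀ v → adj v v ≡ false

open Graph public

Adj : ∀ {n} → Graph n → Fin n → Fin n → Set
Adj G u v = T (adj G u v)

IsDominating : ∀ {n} → Graph n → Subset n → Set
IsDominating {n} G D = ∀ v → v ∉ D → Σ (Fin n) λ u → u ∈ D × Adj G v u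

IsDominationNumber : ∀ {n} → Graph n → ℕ → Set
IsDominationNumber {n} G k =
  (Σ (Subset n) λ D → IsDominating G D × ∣ D ∣ ≡ k)
  × (∀ D → IsDominating G D → k ≤ ∣ D ∣)

CartAdj : ∀ {n₁ n₂} → Graph n₁ → Graph n₂ → (Fin n₁ × Fin n₂) → (Fin n₁ × Fin n₂) → Set
CartAdj G H (g , h) (g' , h') = (g ≡ g' × Adj H h h') ⊎ (Adj G g g' × h ≡ h')

IsRomanDominating : ∀ {n₁ n₂} → Graph n₁ → Graph n₂ → (Fin n₁ → Fin n₂ → ℕ) → Set
IsRomanDominating {n₁} {n₂} G H f =
  (∀ g h → f g h ≤ 2) ×
  (∀ g h → f g h ≡ 0 →
     Σ (Fin n₁ × Fin n₂) λ { (g' , h') → CartAdj G H (g , h) (g' , h') × f g' h' ≡ 2 })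

weight : ∀ {n₁ n₂} → (Fin n₁ → Fin n₂ → ℕ) → ℕ
weight {n₁} {n₂} f = sum (map (λ g → sum (map (λ h → f g h) (allFin n₂))) (allFin n₁))

-- γ_R(G □ H) ≤ b: there is a Roman dominating function of weight ≤ b
-- (the minimum exists since the domain is finite and f ≡ 2 is Roman dominating).
RomanDomNumber≤ : ∀ {n₁ n₂} → Graph n₁ → Graph n₂ → ℕ → Set
RomanDomNumber≤ {n₁} {n₂} G H b =
  Σ (Fin n₁ → Fin n₂ → ℕ) λ f → IsRomanDominating G H f × weight f ≤ b

-- For dominating sets A of G and B of H, put 2 on A × B, 1 on
-- (V(G) ∖ A) × (V(H) ∖ B) and 0 elsewhere.  A vertex of value 0 has exactly
-- one coordinate in its dominating set; moving the other coordinate to a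
-- neighbour in the other dominating set reaches a vertex of A × B along an
-- edge of G □ H.  The weight is 2|A||B| + |V(G) ∖ A||V(H) ∖ B|, and minimum
-- dominating sets give the bound.
module Submission where

open import Defs hiding (sym)
open import Data.Nat using (ℕ; zero; suc; _+_; _*_; _∸_; _≤_; z≤n; s≤s)
open import Data.Nat.Properties using (+-*-semiring; *-assoc; ≤-refl; ≤-reflexive)
open import Data.Nat.ListAction using (sum)
open import Data.Bool using (Bool; true; false; not)
open import Data.Fin using (Fin)
open import Data.Fin.Subset using (Subset; ∁; ∣_∣; _∉_)
open import Data.Fin.Subset.Properties using (∣∁p∣≡n∸∣p∣)
open import Data.Vec using ([]; _∷_; lookup)
open import Data.Vec.Properties using (lookup-map; []=⇒lookup)
open import Data.List using (map; allFin; tabulate)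
open import Data.List.Properties using (map-tabulate)
open import Data.Product using (Σ; _×_; _,_)
open import Data.Sum using (inj₁; inj₂)
open import Function using (id; _∘_)
open import Relation.Binary.PropositionalEquality
  using (_≡_; refl; sym; trans; cong; cong₂; module ≡-Reasoning)

open import Algebra.Properties.Semiring.Sum +-*-semiring
  using (sum-syntax; ∑-distrib-+; *-distribˡ-sum; *-distribʳ-sum; sum-cong-≗)
  renaming (sum to ∑)

sum-tabulate : ∀ {n} (u : Fin n → ℕ) → sum (tabulate u) ≡ ∑ u
sum-tabulate {zero}  u = refl
sum-tabulate {suc n} u = cong (u Fin.zero +_) (sum-tabulate (u ∘ Fin.suc))

sum-map-allFin : ∀ {n} (u : Fin n → ℕ) → sum (map u (allFin n)) ≡ ∑ u
sum-map-allFin u = trans (cong sum (map-tabulate id u)) (sum-tabulate u)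

weight≡∑∑ : ∀ {n₁ n₂} (f : Fin n₁ → Fin n₂ → ℕ) → weight f ≡ ∑[ g < n₁ ] ∑ (f g)
weight≡∑∑ {n₁} f = trans (sum-map-allFin {n₁} _) (sum-cong-≗ (λ g → sum-map-allFin (f g)))

∑-*ˡ : ∀ {n} k (u : Fin n → ℕ) → ∑[ x < n ] (k * u x) ≡ k * ∑ u
∑-*ˡ k u = sym (*-distribˡ-sum k u)

∑∑-distrib-+ : ∀ {n₁ n₂} (f f′ : Fin n₁ → Fin n₂ → ℕ) →
  ∑[ g < n₁ ] ∑[ h < n₂ ] (f g h + f′ g h) ≡ ∑[ g < n₁ ] ∑ (f g) + ∑[ g < n₁ ] ∑ (f′ g)
∑∑-distrib-+ f f′ =
  trans (sum-cong-≗ (λ g → ∑-distrib-+ (f g) (f′ g))) (∑-distrib-+ (∑ ∘ f) (∑ ∘ f′))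

∑∑-*ˡ : ∀ {n₁ n₂} k (f : Fin n₁ → Fin n₂ → ℕ) →
  ∑[ g < n₁ ] ∑[ h < n₂ ] (k * f g h) ≡ k * ∑[ g < n₁ ] ∑ (f g)
∑∑-*ˡ k f = trans (sum-cong-≗ (λ g → ∑-*ˡ k (f g))) (∑-*ˡ k (∑ ∘ f))

∑∑-separable : ∀ {n₁ n₂} (u : Fin n₁ → ℕ) (v : Fin n₂ → ℕ) →
  ∑[ g < n₁ ] ∑[ h < n₂ ] (u g * v h) ≡ ∑ u * ∑ v
∑∑-separable u v =
  trans (sum-cong-≗ (λ g → ∑-*ˡ (u g) v)) (sym (*-distribʳ-sum (∑ v) u))

𝟙 : Bool → ℕ
𝟙 true  = 1
𝟙 false = 0

indicator : ∀ {n} → Subset n → Fin n → ℕ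
indicator p x = 𝟙 (lookup p x)

∑-indicator : ∀ {n} (p : Subset n) → ∑ (indicator p) ≡ ∣ p ∣
∑-indicator []          = refl
∑-indicator (true ∷ p)  = cong suc (∑-indicator p)
∑-indicator (false ∷ p) = ∑-indicator p

indicator-∁ : ∀ {n} (p : Subset n) x → 𝟙 (not (lookup p x)) ≡ indicator (∁ p) x
indicator-∁ p x = sym (cong 𝟙 (lookup-map x not p))

romanValue : Bool → Bool → ℕ
romanValue true  true  = 2
romanValue false false = 1
romanValue _     _     = 0

romanValue≤2 : ∀ x y → romanValue x y ≤ 2
romanValue≤2 true  true  = ≤-refl
romanValue≤2 true  false = z≤n
romanValue≤2 false true  = z≤n
romanValue≤2 false false = s≤s z≤n

romanValue-expand : ∀ x y → romanValue x y ≡ 2 * (𝟙 x * 𝟙 y) + 𝟙 (not x) * 𝟙 (not y)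
romanValue-expand true  true  = refl
romanValue-expand true  false = refl
romanValue-expand false true  = refl
romanValue-expand false false = refl

productRoman : ∀ {n₁ n₂} → Subset n₁ → Subset n₂ → Fin n₁ → Fin n₂ → ℕ
productRoman A B g h = romanValue (lookup A g) (lookup B h)

productRoman-expand : ∀ {n₁ n₂} (A : Subset n₁) (B : Subset n₂) g h →
  productRoman A B g h
    ≡ 2 * (indicator A g * indicator B h) + indicator (∁ A) g * indicator (∁ B) h
productRoman-expand A B g h =
  trans (romanValue-expand (lookup A g) (lookup B h))
        (cong₂ (λ a b → 2 * (indicator A g * indicator B h) + a * b) (indicator-∁ A g) (indicator-∁ B h))

lookup≡false⇒∉ : ∀ {n} (p : Subset n) x → lookup p x ≡ false → x ∉ p
lookup≡false⇒∉ p x eq x∈p with trans (sym eq) ([]=⇒lookup x∈p)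
... | ()

productRoman-isRomanDominating : ∀ {n₁ n₂} (G : Graph n₁) (H : Graph n₂) {A B} →
  IsDominating G A → IsDominating H B → IsRomanDominating G H (productRoman A B)
productRoman-isRomanDominating {n₁} {n₂} G H {A} {B} domA domB =
  (λ g h → romanValue≤2 (lookup A g) (lookup B h)) , reach
  where
  reach : ∀ g h → productRoman A B g h ≡ 0 →
    Σ (Fin n₁ × Fin n₂) λ { (g′ , h′) → CartAdj G H (g , h) (g′ , h′) × productRoman A B g′ h′ ≡ 2 }
  reach g h _  with lookup A g in A[g] | lookup B h in B[h]
  reach g h () | true  | true
  reach g h () | false | false
  reach g h _  | true  | false with domB h (lookup≡false⇒∉ B h B[h])
  ... | h′ , h′∈B , h~h′ = (g , h′) , inj₁ (refl , h~h′) , cong₂ romanValue A[g] ([]=⇒lookup h′∈B)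
  reach g h _  | false | true  with domA g (lookup≡false⇒∉ A g A[g])
  ... | g′ , g′∈A , g~g′ = (g′ , h) , inj₂ (g~g′ , refl) , cong₂ romanValue ([]=⇒lookup g′∈A) B[h]

weight-productRoman : ∀ {n₁ n₂} (A : Subset n₁) (B : Subset n₂) →
  weight (productRoman A B) ≡ 2 * (∣ A ∣ * ∣ B ∣) + (n₁ ∸ ∣ A ∣) * (n₂ ∸ ∣ B ∣)
weight-productRoman {n₁} {n₂} A B = begin
  weight (productRoman A B)
    ≡⟨ weight≡∑∑ (productRoman A B) ⟩
  ∑[ g < n₁ ] ∑ (productRoman A B g)
    ≡⟨ sum-cong-≗ (sum-cong-≗ ∘ productRoman-expand A B) ⟩
  ∑[ g < n₁ ] ∑[ h < n₂ ] (2 * inA×B g h + in∁A×∁B g h)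
    ≡⟨ ∑∑-distrib-+ (λ g h → 2 * inA×B g h) in∁A×∁B ⟩
  ∑[ g < n₁ ] ∑[ h < n₂ ] (2 * inA×B g h) + ∑[ g < n₁ ] ∑ (in∁A×∁B g)
    ≡⟨ cong₂ _+_ (∑∑-*ˡ 2 inA×B) refl ⟩
  2 * ∑[ g < n₁ ] ∑ (inA×B g) + ∑[ g < n₁ ] ∑ (in∁A×∁B g)
    ≡⟨ cong₂ (λ a b → 2 * a + b) (∑∑-separable (indicator A) (indicator B))
                                 (∑∑-separable (indicator (∁ A)) (indicator (∁ B))) ⟩
  2 * (∑ (indicator A) * ∑ (indicator B)) + ∑ (indicator (∁ A)) * ∑ (indicator (∁ B))
    ≡⟨ cong₂ (λ a b → 2 * a + b) (cong₂ _*_ (∑-indicator A) (∑-indicator B))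
                                 (cong₂ _*_ (∑-indicator (∁ A)) (∑-indicator (∁ B))) ⟩
  2 * (∣ A ∣ * ∣ B ∣) + ∣ ∁ A ∣ * ∣ ∁ B ∣
    ≡⟨ cong₂ (λ a b → 2 * (∣ A ∣ * ∣ B ∣) + a * b) (∣∁p∣≡n∸∣p∣ A) (∣∁p∣≡n∸∣p∣ B) ⟩
  2 * (∣ A ∣ * ∣ B ∣) + (n₁ ∸ ∣ A ∣) * (n₂ ∸ ∣ B ∣) ∎
  where
  open ≡-Reasoning
  inA×B in∁A×∁B : Fin n₁ → Fin n₂ → ℕ
  inA×B g h   = indicator A g * indicator B h
  in∁A×∁B g h = indicator (∁ A) g * indicator (∁ B) h

theorem17 : (n₁ n₂ : ℕ) (G : Graph n₁) (H : Graph n₂) (γG γH : ℕ) →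
    IsDominationNumber G γG → IsDominationNumber H γH →
    RomanDomNumber≤ G H (2 * γG * γH + (n₁ ∸ γG) * (n₂ ∸ γH))
theorem17 n₁ n₂ G H γG γH ((A , domA , refl) , _) ((B , domB , refl) , _) =
  productRoman A B ,
  productRoman-isRomanDominating G H domA domB ,
  ≤-reflexive (trans (weight-productRoman A B) (cong (_+ (n₁ ∸ ∣ A ∣) * (n₂ ∸ ∣ B ∣)) reassociate))
  where
  reassociate : 2 * (∣ A ∣ * ∣ B ∣) ≡ 2 * ∣ A ∣ * ∣ B ∣
  reassociate = sym (*-assoc 2 ∣ A ∣ ∣ B ∣)
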